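{- Let $G$ be a graph and let $G^{1/2}$ be the graph obtained from $G$ by subdividing every edge exactly once. For a permutation $\sigma$ of $V(G)$, let $C_{G,\sigma}$ be the collection of open intervals $(\sigma(u),\sigma(v))$ over all edges $\{u,v\} \in E(G)$ with $\sigma(u)<\sigma(v)$. Then $$\pi(G^{1/2}) \leq \min_{\sigma} \dim(C_{G,\sigma}) + 2,$$ where the minimum is taken over all permutations $\sigma$ of $V(G)$.
   Context: All graphs are finite, simple and undirected. Subdividing an edge $\{x,y\}$ once means replacing it by a path $x, w, y$ through a new vertex $w$ of degree $2$. A permutation of a finite set $U$ is a bijection $\sigma: U \to [|U|]$. For disjoint $A,B \subseteq U$, write $A \prec_\sigma B$ if $\sigma(a)<\sigma(b)$ for all $a \in A$, $b \in B$; $\sigma$ separates $A$ and $B$ if $A \prec_\sigma B$ or $B \prec_\sigma A$. A family $\mathcal{F}$ of permutations of $V(H)$ is pairwise suitable for a graph $H$ if for every two disjoint edges $e,f$ of $H$ (viewed as 2-element vertex sets) some $\sigma \in \mathcal{F}$ separates $e$ and $f$. The separation dimension $\pi(H)$ is the minimum cardinality of a family of permutations of $V(H)$ that is pairwise suitable for $H$. For a collection $C$ of open intervals $(a,b)$ ($a<b$ reals), the interval order of $C$ is the partial order $\lhd$ on $C$ with $(a,b) \lhd (c,d)$ iff $b \leq c$. A linear extension of a poset $P$ is a total order on its elements containing all relations of $P$; a realiser of $P$ is a set $\mathcal{R}$ of linear extensions such that for distinct $x,y$, $x \lhd y$ in $P$ iff $x$ precedes $y$ in every $L \in \mathcal{R}$.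 The poset dimension of $P$ is the minimum size of a realiser. The interval dimension $\dim(C)$ is the poset dimension of the interval order of $C$. -}

module Defs where

open import Data.Nat using (ℕ; _≤_; _+_; _⊓_; _⊔_)
open import Data.Fin using (Fin; toℕ; _<_)
open import Data.Bool using (Bool; T)
open import Data.Empty using (⊥)
open import Data.Product using (Σ; Σ-syntax; ∃-syntax; _×_)
open import Data.Sum using (_⊎_; inj₁; inj₂)
open import Data.List using (List; length)
open import Data.List.Membership.Propositional using (_∈_)
open import Relation.Binary.PropositionalEquality using (_≡_; _≢_)
open import Relation.Nullary using (¬_)
open import Function.Bundles using (_⤖_; _⇔_; Bijection)

record Graph : Set₁ where
  field
    V   : Set
    Adj : V → V → Set

open Graph public

-- A permutation of a finite set U: a bijection U → [k] (here Fin k = {0,…,k-1};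
-- k is then necessarily |U|).  Only relative order is ever used.
Perm : Set → ℕ → Set
Perm U k = U ⤖ Fin k

rank : {U : Set} {k : ℕ} → Perm U k → U → Fin k
rank σ = Bijection.to σ

Prec : {U : Set} {k : ℕ} → Perm U k → U → U → U → U → Set
Prec σ a b c d =
  (rank σ a < rank σ c) × (rank σ a < rank σ d) ×
  (rank σ b < rank σ c) × (rank σ b < rank σ d)

Separates : {U : Set} {k : ℕ} → Perm U k → U → U → U → U → Set
Separates σ a b c d = Prec σ a b c d ⊎ Prec σ c d a b

PairwiseSuitable : (H : Graph) {k : ℕ} → List (Perm (V H) k) → Set
PairwiseSuitable H F =
  ∀ a b c d → Adj H a b → Adj H c d →
  a ≢ c → a ≢ d → b ≢ c → b ≢ d →
  Σ[ σ ∈ _ ] (σ ∈ F × Separates σ a b c d)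

SepDimAtMost : Graph → ℕ → Set
SepDimAtMost H t =
  Σ[ k ∈ ℕ ] Σ[ F ∈ List (Perm (V H) k) ] (length F ≤ t × PairwiseSuitable H F)

IsSimple : {n : ℕ} → (Fin n → Fin n → Bool) → Set
IsSimple {n} A = (∀ u v → A u v ≡ A v u) × (∀ u → ¬ T (A u u))

-- Edges of G, each unordered edge {u,v} represented once by u < v.
Edge : (n : ℕ) → (Fin n → Fin n → Bool) → Set
Edge n A = Σ[ u ∈ Fin n ] Σ[ v ∈ Fin n ] (u < v × T (A u v))

endpoint : {n : ℕ} {A : Fin n → Fin n → Bool} → Fin n → Edge n A → Set
endpoint x (u Data.Product., v Data.Product., _) = (x ≡ u) ⊎ (x ≡ v)

SubAdj : (n : ℕ) (A : Fin n → Fin n → Bool) → (Fin n ⊎ Edge n A) → (Fin n ⊎ Edge n A) → Set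
SubAdj n A (inj₁ _) (inj₁ _) = ⊥
SubAdj n A (inj₁ x) (inj₂ e) = endpoint x e
SubAdj n A (inj₂ e) (inj₁ x) = endpoint x e
SubAdj n A (inj₂ _) (inj₂ _) = ⊥

Subdivide : (n : ℕ) → (Fin n → Fin n → Bool) → Graph
Subdivide n A = record { V = Fin n ⊎ Edge n A ; Adj = SubAdj n A }

-- The interval collection C_{G,σ}: one open interval (σ(u),σ(v)) for each
-- edge {u,v} oriented so that σ(u) < σ(v).  (Distinct edges give distinct
-- intervals since σ is injective, so C is indexed by these oriented edges.)

CG : (n : ℕ) → (Fin n → Fin n → Bool) → Perm (Fin n) n → Set
CG n A σ = Σ[ u ∈ Fin n ] Σ[ v ∈ Fin n ] (T (A u v) × rank σ u < rank σ v)

left right : {n : ℕ} {A : Fin n → Fin n → Bool} {σ : Perm (Fin n) n} → CG n A σ → ℕ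
left  {σ = σ} (u Data.Product., _) = toℕ (rank σ u)
right {σ = σ} (_ Data.Product., v Data.Product., _) = toℕ (rank σ v)

IntervalOrder : {n : ℕ} {A : Fin n → Fin n → Bool} {σ : Perm (Fin n) n} →
                CG n A σ → CG n A σ → Set
IntervalOrder {A = A} {σ = σ} I J = right {A = A} {σ = σ} I ≤ left {A = A} {σ = σ} J

-- Posets, linear extensions, realisers (for a strict order _◁_ on X).
-- A total order on the finite set X is given by a ranking bijection X → Fin m.

LinearExtension : (X : Set) → (X → X → Set) → Set
LinearExtension X _◁_ =
  Σ[ m ∈ ℕ ] Σ[ L ∈ Perm X m ] (∀ x y → x ◁ y → rank L x < rank L y)

precedes : {X : Set} {_◁_ : X → X → Set} → LinearExtension X _◁_ → X → X → Set
precedes (m Data.Product., L Data.Product., _) x y = rank L x < rank L y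

IsRealiser : (X : Set) (_◁_ : X → X → Set) → List (LinearExtension X _◁_) → Set
IsRealiser X _◁_ R =
  ∀ x y → x ≢ y → (x ◁ y ⇔ (∀ L → L ∈ R → precedes {X} {_◁_} L x y))

-- Order V(G) by σ, so that each edge e of G is the interval from its lower endpoint
-- lo e to its upper endpoint hi e.  Two disjoint edges of G^{1/2} have the form {x, e},
-- {y, f} with x an endpoint of e, y an endpoint of f, x ≠ y and e ≠ f.  If x and y are
-- both lower endpoints, they are separated by following σ and putting every edge-vertex
-- right after its lower endpoint; if both are upper endpoints, by putting every
-- edge-vertex right before its upper endpoint.  If x = lo e and y = hi f, then either
-- hi f comes before lo e in σ, and the first of these permutations works, or the interval
-- of f does not precede that of e, so some linear extension L in the realiser puts e
-- before f.  Then follow L: put every edge-vertex at the position of its interval in L,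
-- and every vertex v just after the last interval ending by σ(v).  Together with the two
-- permutations above this gives |R| + 2 permutations.

module Submission where

open import Defs
open import Data.Nat as ℕ using (ℕ; zero; suc; _+_; _⊔_; z≤n)
import Data.Nat.Properties as ℕP
open import Data.Fin as F using (Fin; toℕ; fromℕ<; punchOut)
import Data.Fin.Properties as FP
open import Data.Fin.Subset using (Subset; _⊂_; ∣_∣; ⊤) renaming (_∈_ to _∈ₛ_)
open import Data.Fin.Subset.Properties using (∈⊤; ∣⊤∣≡n; p⊂q⇒∣p∣<∣q∣)
open import Data.Vec using (tabulate)
open import Data.Vec.Properties using (lookup∘tabulate; []=⇒lookup; lookup⇒[]=)
open import Data.Bool using (Bool; T)
open import Data.Bool.Properties using (T-irrelevant)
open import Data.Empty using (⊥-elim)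
open import Data.Product using (Σ; Σ-syntax; _×_; _,_; proj₁; proj₂; map₂)
open import Data.Product.Relation.Binary.Lex.Strict using (×-Lex; ×-transitive; ×-compare)
open import Data.Sum using (_⊎_; inj₁; inj₂)
open import Data.Sum.Function.Propositional using (_⊎-↔_)
open import Data.List using (List; _∷_; length; map)
open import Data.List.Properties using (length-map)
open import Data.List.Relation.Unary.Any using (here; there)
open import Data.List.Relation.Unary.All as All using (all?)
open import Data.List.Relation.Unary.All.Properties using (¬All⇒Any¬)
open import Data.List.Membership.Propositional using (_∈_; find)
open import Data.List.Membership.Propositional.Properties using (∈-map⁺)
open import Function using (_∘_)
open import Function.Bundles using (_⤖_; _↔_; mk⤖; mk↔ₛ′; Inverse; Bijection; Equivalence)
open import Function.Construct.Composition using (_⤖-∘_)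
open import Function.Definitions using (Injective; Surjective)
open import Function.Properties.Bijection using (⤖⇒↔)
open import Function.Properties.Inverse using (↔-refl; ↔-sym; ↔-trans; ↔⇒⤖)
open import Level using (Level)
open import Relation.Binary.Core using (Rel)
open import Relation.Binary.Definitions using (Transitive; Trichotomous; tri<; tri≈; tri>)
open import Relation.Binary.Consequences using (tri⇒dec<; tri⇒irr)
open import Relation.Binary.PropositionalEquality
open import Relation.Nullary using (¬_; Dec; yes; no; does; Irrelevant)
open import Relation.Nullary.Decidable using (dec-true; T?; _×-dec_)

Finite : Set → Set
Finite A = Σ[ k ∈ ℕ ] (A ↔ Fin k)

⊎-finite : {A B : Set} → Finite A → Finite B → Finite (A ⊎ B)
⊎-finite (a , A↔) (b , B↔) = a + b , ↔-trans (A↔ ⊎-↔ B↔) (↔-sym FP.+↔⊎)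

proposition-finite : {A : Set} → Dec A → Irrelevant A → Finite A
proposition-finite (no ¬a) _ = 0 , mk↔ₛ′ (⊥-elim ∘ ¬a) (λ ()) (λ ()) (⊥-elim ∘ ¬a)
proposition-finite (yes a) irr = 1 , mk↔ₛ′ (λ _ → F.zero) (λ _ → a) (λ { F.zero → refl ; (F.suc ()) }) (irr a)

Σ-finite : ∀ {n} {B : Fin n → Set} → (∀ i → Finite (B i)) → Finite (Σ (Fin n) B)
Σ-finite {zero} _ = 0 , mk↔ₛ′ (λ ()) (λ ()) (λ ()) (λ ())
Σ-finite {suc n} {B} fin = map₂ (↔-trans Σ↔⊎) (⊎-finite (fin F.zero) (Σ-finite (fin ∘ F.suc)))
  where
  Σ↔⊎ : Σ (Fin (suc n)) B ↔ (B F.zero ⊎ Σ (Fin n) (B ∘ F.suc))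
  Σ↔⊎ = mk↔ₛ′ (λ { (F.zero , b) → inj₁ b ; (F.suc i , b) → inj₂ (i , b) })
              (λ { (inj₁ b) → F.zero , b ; (inj₂ (i , b)) → F.suc i , b })
              (λ { (inj₁ b) → refl ; (inj₂ (i , b)) → refl })
              (λ { (F.zero , b) → refl ; (F.suc i , b) → refl })

injective⇒surjective : ∀ {N} (f : Fin N → Fin N) → Injective _≡_ _≡_ f → Surjective _≡_ _≡_ f
injective⇒surjective {N} f inj y with FP.any? (λ x → f x FP.≟ y)
... | yes (x , fx≡y) = x , λ { refl → fx≡y }
injective⇒surjective {suc M} f inj y | no y∉im
  with i , j , i<j , eq ← FP.pigeonhole (ℕP.n<1+n M) (λ x → punchOut (y∉im ∘ (x ,_) ∘ sym))
  = ⊥-elim (FP.<-irrefl (inj (FP.punchOut-injective {i = y} _ _ eq)) i<j)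

module Ranking {N : ℕ} {ℓ : Level} {_≺_ : Rel (Fin N) ℓ}
               (≺-trans : Transitive _≺_) (compare : Trichotomous _≡_ _≺_) where

  private
    _≺?_ = tri⇒dec< compare

    ≺-irrefl : ∀ {i} → ¬ i ≺ i
    ≺-irrefl = tri⇒irr compare refl

  below : Fin N → Subset N
  below j = tabulate (λ i → does (i ≺? j))

  ∈-below⁺ : ∀ {i j} → i ≺ j → i ∈ₛ below j
  ∈-below⁺ {i} {j} i≺j = lookup⇒[]= i _ (trans (lookup∘tabulate _ i) (dec-true (i ≺? j) i≺j))

  ∈-below⁻ : ∀ {i j} → i ∈ₛ below j → i ≺ j
  ∈-below⁻ {i} {j} i∈ with i ≺? j | trans (sym (lookup∘tabulate _ i)) ([]=⇒lookup i∈)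
  ... | yes i≺j | _ = i≺j
  ... | no _    | ()

  below-⊂ : ∀ {i j} → i ≺ j → below i ⊂ below j
  below-⊂ {i} i≺j =
    (λ k∈ → ∈-below⁺ (≺-trans (∈-below⁻ k∈) i≺j)) , i , ∈-below⁺ i≺j , ≺-irrefl ∘ ∈-below⁻

  below-⊂-⊤ : ∀ j → below j ⊂ ⊤
  below-⊂-⊤ j = (λ _ → ∈⊤) , j , ∈⊤ , ≺-irrefl ∘ ∈-below⁻

  position : Fin N → Fin N
  position j = fromℕ< (subst (∣ below j ∣ ℕ.<_) (∣⊤∣≡n N) (p⊂q⇒∣p∣<∣q∣ (below-⊂-⊤ j)))

  position-mono : ∀ {i j} → i ≺ j → position i F.< position j
  position-mono i≺j =
    subst₂ ℕ._<_ (sym (FP.toℕ-fromℕ< _)) (sym (FP.toℕ-fromℕ< _)) (p⊂q⇒∣p∣<∣q∣ (below-⊂ i≺j))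

  position-injective : Injective _≡_ _≡_ position
  position-injective {i} {j} eq with compare i j
  ... | tri< i≺j _ _ = ⊥-elim (FP.<-irrefl eq (position-mono i≺j))
  ... | tri≈ _ i≡j _ = i≡j
  ... | tri> _ _ j≺i = ⊥-elim (FP.<-irrefl (sym eq) (position-mono j≺i))

  ranking : Fin N ⤖ Fin N
  ranking = mk⤖ (position-injective , injective⇒surjective position position-injective)

-- Elements with equal keys are ordered by the enumeration.
module KeyOrder {U : Set} {N : ℕ} (enum : U ↔ Fin N) where

  open Inverse enum using (from; strictlyInverseʳ)

  module _ (key : U → ℕ) where

    private
      tag : Fin N → ℕ × Fin N
      tag j = key (from j) , j

      _⊏_ : Rel (Fin N) _
      i ⊏ j = ×-Lex _≡_ ℕ._<_ F._<_ (tag i) (tag j)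

      ⊏-trans : Transitive _⊏_
      ⊏-trans = ×-transitive {_<₂_ = F._<_} isEquivalence (resp₂ ℕ._<_) ℕP.<-trans FP.<-trans

      ⊏-compare : Trichotomous _≡_ _⊏_
      ⊏-compare i j with ×-compare sym ℕP.<-cmp FP.<-cmp (tag i) (tag j)
      ... | tri< i⊏j i≉j j⊏̸i = tri< i⊏j (λ { refl → i≉j (refl , refl) }) j⊏̸i
      ... | tri≈ i⊏̸j i≈j j⊏̸i = tri≈ i⊏̸j (proj₂ i≈j) j⊏̸i
      ... | tri> i⊏̸j i≉j j⊏i = tri> i⊏̸j (λ { refl → i≉j (refl , refl) }) j⊏i

    -- Opaque so that unification never unfolds the ranking.
    abstract
     byKey : Perm U N
     byKey = Ranking.ranking ⊏-trans ⊏-compare ⤖-∘ ↔⇒⤖ enum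

     byKey-mono : ∀ {a b} → key a ℕ.< key b → rank byKey a F.< rank byKey b
     byKey-mono {a} {b} ka<kb = Ranking.position-mono ⊏-trans ⊏-compare
      (inj₁ (subst₂ ℕ._<_ (sym (cong key (strictlyInverseʳ a))) (sym (cong key (strictlyInverseʳ b))) ka<kb))

  -- Keys X + X and 1 + (X + X) place an element in slot X; earlier slots come first.
  Prec-byKey : ∀ key {a b c d} X Y → X ℕ.< Y →
               key a ℕ.≤ suc (X + X) → key b ℕ.≤ suc (X + X) →
               Y + Y ℕ.≤ key c → Y + Y ℕ.≤ key d → Prec (byKey key) a b c d
  Prec-byKey key X Y X<Y ka kb kc kd = below ka kc , below ka kd , below kb kc , below kb kd
    where
    slot< : suc (X + X) ℕ.< Y + Y
    slot< = subst (ℕ._≤ Y + Y) (ℕP.+-suc (suc X) X) (ℕP.+-mono-≤ X<Y X<Y)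

    below : ∀ {u v} → key u ℕ.≤ suc (X + X) → Y + Y ℕ.≤ key v → rank (byKey key) u F.< rank (byKey key) v
    below ku kv = byKey-mono key (ℕP.≤-<-trans ku (ℕP.<-≤-trans slot< kv))

  InSlot : (U → ℕ) → U → ℕ → Set
  InSlot key u X = X + X ℕ.≤ key u × key u ℕ.≤ suc (X + X)

  Separates-byKey : ∀ key {a b c d X Y} → X ≢ Y →
                    InSlot key a X → InSlot key b X → InSlot key c Y → InSlot key d Y →
                    Separates (byKey key) a b c d
  Separates-byKey key {X = X} {Y} X≢Y a b c d with ℕP.<-cmp X Y
  ... | tri< X<Y _ _ = inj₁ (Prec-byKey key X Y X<Y (proj₂ a) (proj₂ b) (proj₁ c) (proj₁ d))
  ... | tri≈ _ X≡Y _ = ⊥-elim (X≢Y X≡Y)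
  ... | tri> _ _ Y<X = inj₂ (Prec-byKey key Y X Y<X (proj₂ c) (proj₂ d) (proj₁ a) (proj₁ b))

module _ {U : Set} {k : ℕ} (π : Perm U k) where

  Separates-swapˡ : ∀ {a b c d} → Separates π a b c d → Separates π b a c d
  Separates-swapˡ (inj₁ (ac , ad , bc , bd)) = inj₁ (bc , bd , ac , ad)
  Separates-swapˡ (inj₂ (ca , cb , da , db)) = inj₂ (cb , ca , db , da)

  Separates-swapʳ : ∀ {a b c d} → Separates π a b c d → Separates π a b d c
  Separates-swapʳ (inj₁ (ac , ad , bc , bd)) = inj₁ (ad , ac , bd , bc)
  Separates-swapʳ (inj₂ (ca , cb , da , db)) = inj₂ (da , db , ca , cb)

  Separates-sym : ∀ {a b c d} → Separates π a b c d → Separates π c d a b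
  Separates-sym (inj₁ p) = inj₂ p
  Separates-sym (inj₂ p) = inj₁ p

maximum : ∀ {m} → (Fin m → ℕ) → ℕ
maximum {zero} g = 0
maximum {suc m} g = g F.zero ⊔ maximum (g ∘ F.suc)

≤-maximum : ∀ {m} (g : Fin m → ℕ) j → g j ℕ.≤ maximum g
≤-maximum g F.zero = ℕP.m≤m⊔n _ _
≤-maximum g (F.suc j) = ℕP.≤-trans (≤-maximum (g ∘ F.suc) j) (ℕP.m≤n⊔m (g F.zero) _)

maximum-least : ∀ {m} (g : Fin m → ℕ) {b} → (∀ j → g j ℕ.≤ b) → maximum g ℕ.≤ b
maximum-least {zero} g h = z≤n
maximum-least {suc m} g h = ℕP.⊔-lub (h F.zero) (maximum-least (g ∘ F.suc) (h ∘ F.suc))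

module Construction (n : ℕ) (A : Fin n → Fin n → Bool) (simple : IsSimple A)
                    (σ : Perm (Fin n) n) where

  private
    E = Edge n A
    Interval = CG n A σ
    Vertex½ = V (Subdivide n A)

    _◁_ : Interval → Interval → Set
    _◁_ = IntervalOrder {n} {A} {σ}

  pos : Fin n → ℕ
  pos v = toℕ (rank σ v)

  pos-injective : ∀ {u v} → pos u ≡ pos v → u ≡ v
  pos-injective = Bijection.injective σ ∘ FP.toℕ-injective

  interval : E → Interval
  interval (u , v , u<v , uv) with rank σ u F.<? rank σ v
  ... | yes σu<σv = u , v , uv , σu<σv
  ... | no σu≮σv = v , u , subst T (proj₁ simple u v) uv ,
                   ℕP.≤∧≢⇒< (ℕP.≮⇒≥ σu≮σv) (λ eq → FP.<-irrefl (sym (pos-injective eq)) u<v)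

  lo hi : E → Fin n
  lo e = proj₁ (interval e)
  hi e = proj₁ (proj₂ (interval e))

  lo<hi : ∀ e → pos (lo e) ℕ.< pos (hi e)
  lo<hi e = proj₂ (proj₂ (proj₂ (interval e)))

  endpoint⇒lo⊎hi : ∀ {x} e → endpoint {n} {A} x e → x ≡ lo e ⊎ x ≡ hi e
  endpoint⇒lo⊎hi (u , v , _ , _) x∈e with rank σ u F.<? rank σ v | x∈e
  ... | yes _ | inj₁ x≡u = inj₁ x≡u
  ... | yes _ | inj₂ x≡v = inj₂ x≡v
  ... | no _  | inj₁ x≡u = inj₂ x≡u
  ... | no _  | inj₂ x≡v = inj₁ x≡v

  edge-≡ : ∀ {u v u′ v′} (p : u F.< v) (t : T (A u v)) (p′ : u′ F.< v′) (t′ : T (A u′ v′)) →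
           u ≡ u′ → v ≡ v′ → _≡_ {A = E} (u , v , p , t) (u′ , v′ , p′ , t′)
  edge-≡ p t p′ t′ refl refl = cong₂ (λ p t → _ , _ , p , t) (FP.<-irrelevant p p′) (T-irrelevant t t′)

  interval-injective : ∀ {e f} → interval e ≡ interval f → e ≡ f
  interval-injective {e} {f} eq = go e f (cong proj₁ eq) (cong (proj₁ ∘ proj₂) eq)
    where
    go : ∀ e f → lo e ≡ lo f → hi e ≡ hi f → e ≡ f
    go (u , v , p , t) (u′ , v′ , p′ , t′) lo≡ hi≡
      with rank σ u F.<? rank σ v | rank σ u′ F.<? rank σ v′
    ... | yes _ | yes _ = edge-≡ p t p′ t′ lo≡ hi≡
    ... | no _  | no _  = edge-≡ p t p′ t′ hi≡ lo≡
    ... | yes _ | no _  = ⊥-elim (ℕP.<-asym p (subst₂ F._<_ (sym hi≡) (sym lo≡) p′))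
    ... | no _  | yes _ = ⊥-elim (ℕP.<-asym p (subst₂ F._<_ (sym lo≡) (sym hi≡) p′))

  vertices-finite : Finite Vertex½
  vertices-finite = ⊎-finite (n , ↔-refl) (Σ-finite λ u → Σ-finite λ v →
    proposition-finite (u F.<? v ×-dec T? (A u v))
                       (λ (p , t) (p′ , t′) → cong₂ _,_ (FP.<-irrelevant p p′) (T-irrelevant t t′)))

  N : ℕ
  N = proj₁ vertices-finite

  open KeyOrder (proj₂ vertices-finite)

  afterLowerKey beforeUpperKey : Vertex½ → ℕ
  afterLowerKey  (inj₁ v) = pos v + pos v
  afterLowerKey  (inj₂ e) = suc (pos (lo e) + pos (lo e))
  beforeUpperKey (inj₁ v) = suc (pos v + pos v)
  beforeUpperKey (inj₂ e) = pos (hi e) + pos (hi e)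

  afterLower beforeUpper : Perm Vertex½ N
  afterLower  = byKey afterLowerKey
  beforeUpper = byKey beforeUpperKey

  afterLower-separates : ∀ e f → lo e ≢ lo f →
                         Separates afterLower (inj₁ (lo e)) (inj₂ e) (inj₁ (lo f)) (inj₂ f)
  afterLower-separates e f lo≢ = Separates-byKey afterLowerKey (lo≢ ∘ pos-injective)
    (ℕP.≤-refl , ℕP.n≤1+n _) (ℕP.n≤1+n _ , ℕP.≤-refl)
    (ℕP.≤-refl , ℕP.n≤1+n _) (ℕP.n≤1+n _ , ℕP.≤-refl)

  beforeUpper-separates : ∀ e f → hi e ≢ hi f →
                        Separates beforeUpper (inj₁ (hi e)) (inj₂ e) (inj₁ (hi f)) (inj₂ f)
  beforeUpper-separates e f hi≢ = Separates-byKey beforeUpperKey (hi≢ ∘ pos-injective)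
    (ℕP.n≤1+n _ , ℕP.≤-refl) (ℕP.≤-refl , ℕP.n≤1+n _)
    (ℕP.n≤1+n _ , ℕP.≤-refl) (ℕP.≤-refl , ℕP.n≤1+n _)

  afterLower-precedes : ∀ e f → pos (hi f) ℕ.< pos (lo e) →
                        Prec afterLower (inj₁ (hi f)) (inj₂ f) (inj₁ (lo e)) (inj₂ e)
  afterLower-precedes e f lt = Prec-byKey afterLowerKey _ _ lt (ℕP.n≤1+n _)
    (ℕ.s≤s (ℕP.+-mono-≤ (ℕP.<⇒≤ (lo<hi f)) (ℕP.<⇒≤ (lo<hi f)))) ℕP.≤-refl (ℕP.n≤1+n _)

  module Along {m : ℕ} (L : Perm Interval m) (extends : ∀ I J → I ◁ J → rank L I F.< rank L J) where

    open Inverse (⤖⇒↔ L) using (from; strictlyInverseˡ; strictlyInverseʳ)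

    place : Interval → ℕ
    place I = toℕ (rank L I)

    endsBy : Fin n → Fin m → ℕ
    endsBy v j with right {n} {A} {σ} (from j) ℕP.≤? pos v
    ... | yes _ = suc (toℕ j)
    ... | no _  = 0

    endsBy-≥ : ∀ v j → right {n} {A} {σ} (from j) ℕ.≤ pos v → suc (toℕ j) ℕ.≤ endsBy v j
    endsBy-≥ v j I≤v with right {n} {A} {σ} (from j) ℕP.≤? pos v
    ... | yes _  = ℕP.≤-refl
    ... | no I≰v = ⊥-elim (I≰v I≤v)

    -- Vertex v is placed just after every interval that ends by σ(v); as L extends
    -- the interval order, this is before every interval that starts at or after σ(v).
    entry : Fin n → ℕ
    entry v = maximum (endsBy v)

    place<entry : ∀ I v → right {n} {A} {σ} I ℕ.≤ pos v → place I ℕ.< entry v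
    place<entry I v I≤v = ℕP.≤-trans
      (endsBy-≥ v (rank L I) (subst (λ I → right {n} {A} {σ} I ℕ.≤ pos v) (sym (strictlyInverseʳ I)) I≤v))
      (≤-maximum (endsBy v) (rank L I))

    entry≤place : ∀ v J → pos v ℕ.≤ left {n} {A} {σ} J → entry v ℕ.≤ place J
    entry≤place v J v≤J = maximum-least (endsBy v) bound
      where
      bound : ∀ j → endsBy v j ℕ.≤ place J
      bound j with right {n} {A} {σ} (from j) ℕP.≤? pos v
      ... | yes I≤v = subst (λ k → suc (toℕ k) ℕ.≤ place J) (strictlyInverseˡ j)
                            (extends (from j) J (ℕP.≤-trans I≤v v≤J))
      ... | no _  = z≤n

    key : Vertex½ → ℕ
    key (inj₁ v) = entry v + entry v
    key (inj₂ e) = suc (place (interval e) + place (interval e))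

    perm : Perm Vertex½ N
    perm = byKey key

    perm-precedes : ∀ e f → place (interval e) ℕ.< place (interval f) →
                    Prec perm (inj₁ (lo e)) (inj₂ e) (inj₁ (hi f)) (inj₂ f)
    perm-precedes e f e<f = Prec-byKey key (place (interval e)) (place (interval f)) e<f
      (ℕP.m≤n⇒m≤1+n (double-mono (entry≤place (lo e) (interval e) ℕP.≤-refl)))
      ℕP.≤-refl
      (double-mono (ℕP.<⇒≤ (place<entry (interval f) (hi f) ℕP.≤-refl)))
      (ℕP.n≤1+n _)
      where
      double-mono : ∀ {x y} → x ℕ.≤ y → x + x ℕ.≤ y + y
      double-mono x≤y = ℕP.+-mono-≤ x≤y x≤y

  private
    Extension = LinearExtension Interval _◁_

  along : Extension → Perm Vertex½ N
  along (_ , L , extends) = Along.perm L extends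

  placeIn : Extension → Interval → ℕ
  placeIn (_ , L , _) I = toℕ (rank L I)

  placeIn-injective : ∀ L {I J} → placeIn L I ≡ placeIn L J → I ≡ J
  placeIn-injective (_ , L , _) = Bijection.injective L ∘ FP.toℕ-injective

  along-precedes : ∀ L e f → placeIn L (interval e) ℕ.< placeIn L (interval f) →
                   Prec (along L) (inj₁ (lo e)) (inj₂ e) (inj₁ (hi f)) (inj₂ f)
  along-precedes (_ , L , extends) = Along.perm-precedes L extends

  module _ (R : List Extension) (realiser : IsRealiser Interval _◁_ R) where

    family : List (Perm Vertex½ N)
    family = afterLower ∷ beforeUpper ∷ map along R

    length-family : length family ℕ.≤ length R + 2
    length-family = ℕP.≤-reflexive (trans (cong (2 +_) (length-map along R)) (ℕP.+-comm 2 (length R)))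

    Separated : Fin n → E → Fin n → E → Set
    Separated x e y f =
      Σ[ π ∈ Perm Vertex½ N ] (π ∈ family × Separates π (inj₁ x) (inj₂ e) (inj₁ y) (inj₂ f))

    reversed-in-some-extension : ∀ e f → e ≢ f → ¬ interval f ◁ interval e →
                                 Σ[ L ∈ Extension ] (L ∈ R × placeIn L (interval e) ℕ.< placeIn L (interval f))
    reversed-in-some-extension e f e≢f f⋪e with all? (λ L → placeIn L (interval f) ℕP.<? placeIn L (interval e)) R
    ... | yes all-f<e = ⊥-elim (f⋪e (Equivalence.from (realiser _ _ (e≢f ∘ sym ∘ interval-injective))
                                                       (λ L → All.lookup all-f<e)))
    ... | no ¬all with find (¬All⇒Any¬ (λ L → placeIn L (interval f) ℕP.<? placeIn L (interval e)) R ¬all)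
    ... | L , L∈R , f≮e =
      L , L∈R , ℕP.≤∧≢⇒< (ℕP.≮⇒≥ f≮e) (e≢f ∘ interval-injective ∘ placeIn-injective L)

    lower-upper-separated : ∀ e f → lo e ≢ hi f → e ≢ f → Separated (lo e) e (hi f) f
    lower-upper-separated e f lo≢hi e≢f = by-cases (pos (hi f) ℕP.≤? pos (lo e))
      where
      by-cases : Dec (pos (hi f) ℕ.≤ pos (lo e)) → Separated (lo e) e (hi f) f
      by-cases (yes f≤e) = afterLower , here refl ,
        inj₂ (afterLower-precedes e f (ℕP.≤∧≢⇒< f≤e (lo≢hi ∘ sym ∘ pos-injective)))
      by-cases (no f≰e) with reversed-in-some-extension e f e≢f f≰e
      ... | L , L∈R , e<f = along L , there (there (∈-map⁺ along L∈R)) , inj₁ (along-precedes L e f e<f)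

    endpoints-separated : ∀ x e y f → endpoint {n} {A} x e → endpoint {n} {A} y f → x ≢ y → e ≢ f →
                          Separated x e y f
    endpoints-separated x e y f x∈e y∈f x≢y e≢f with endpoint⇒lo⊎hi e x∈e | endpoint⇒lo⊎hi f y∈f
    ... | inj₁ refl | inj₁ refl = afterLower , here refl , afterLower-separates e f x≢y
    ... | inj₂ refl | inj₂ refl = beforeUpper , there (here refl) , beforeUpper-separates e f x≢y
    ... | inj₁ refl | inj₂ refl = lower-upper-separated e f x≢y e≢f
    ... | inj₂ refl | inj₁ refl with lower-upper-separated f e (x≢y ∘ sym) (e≢f ∘ sym)
    ... | π , π∈ , sep = π , π∈ , Separates-sym π sep

    suitable : PairwiseSuitable (Subdivide n A) family
    suitable (inj₁ x) (inj₂ e) (inj₁ y) (inj₂ f) x∈e y∈f x≢y _ _ e≢f =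
      endpoints-separated x e y f x∈e y∈f (x≢y ∘ cong inj₁) (e≢f ∘ cong inj₂)
    suitable (inj₂ e) (inj₁ x) (inj₁ y) (inj₂ f) x∈e y∈f _ e≢f x≢y _
      with endpoints-separated x e y f x∈e y∈f (x≢y ∘ cong inj₁) (e≢f ∘ cong inj₂)
    ... | π , π∈ , sep = π , π∈ , Separates-swapˡ π sep
    suitable (inj₁ x) (inj₂ e) (inj₂ f) (inj₁ y) x∈e y∈f _ x≢y e≢f _
      with endpoints-separated x e y f x∈e y∈f (x≢y ∘ cong inj₁) (e≢f ∘ cong inj₂)
    ... | π , π∈ , sep = π , π∈ , Separates-swapʳ π sep
    suitable (inj₂ e) (inj₁ x) (inj₂ f) (inj₁ y) x∈e y∈f e≢f _ _ x≢y
      with endpoints-separated x e y f x∈e y∈f (x≢y ∘ cong inj₁) (e≢f ∘ cong inj₂)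
    ... | π , π∈ , sep = π , π∈ , Separates-swapˡ π (Separates-swapʳ π sep)
    suitable (inj₁ _) (inj₁ _) _ _ ()
    suitable (inj₂ _) (inj₂ _) _ _ ()
    suitable (inj₁ _) (inj₂ _) (inj₁ _) (inj₁ _) _ ()
    suitable (inj₁ _) (inj₂ _) (inj₂ _) (inj₂ _) _ ()
    suitable (inj₂ _) (inj₁ _) (inj₁ _) (inj₁ _) _ ()
    suitable (inj₂ _) (inj₁ _) (inj₂ _) (inj₂ _) _ ()

lemma2 : (n : ℕ) (A : Fin n → Fin n → Bool) → IsSimple A →
         (σ : Perm (Fin n) n) →
         (R : List (LinearExtension (CG n A σ) (IntervalOrder {n} {A} {σ}))) →
         IsRealiser (CG n A σ) (IntervalOrder {n} {A} {σ}) R →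
         SepDimAtMost (Subdivide n A) (length R + 2)
lemma2 n A simple σ R realiser = N , family R realiser , length-family R realiser , suitable R realiser
  where open Construction n A simple σ
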